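{- The intermediate logic $\mathbf{LV}$ has the Lyndon interpolation property: whenever $\mathbf{LV}\vdash\varphi\to\psi$, there is a formula $\rho$ with $v^\circ(\rho)\subseteq v^\circ(\varphi)\cap v^\circ(\psi)$ for $\circ\in\{+,-\}$, $\mathbf{LV}\vdash\varphi\to\rho$ and $\mathbf{LV}\vdash\rho\to\psi$.
   Context: Propositional formulas are built from variables, $\bot$, $\land,\lor,\neg,\to$. $v^+(p)=\{p\}$, $v^-(p)=\emptyset$, $v^\circ(\bot)=\emptyset$, $v^\circ(\varphi\ast\psi)=v^\circ(\varphi)\cup v^\circ(\psi)$ for $\ast\in\{\land,\lor\}$, $v^\pm(\neg\varphi)=v^\mp(\varphi)$, $v^+(\varphi\to\psi)=v^-(\varphi)\cup v^+(\psi)$, $v^-(\varphi\to\psi)=v^+(\varphi)\cup v^-(\psi)$. $\mathbf{LV}$ is the intermediate logic of the intuitionistic Kripke frame consisting of a root with exactly two distinct maximal points above it (i.e. the set of formulas intuitionistically valid on the three-element poset $\{r,a,b\}$ with $r<a$, $r<b$). -}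

module Defs where

open import Data.Nat using (ℕ)
open import Data.List using (List; []; [_]; _++_)
open import Data.Empty using (⊥)
open import Data.Bool using (Bool; T)
open import Data.Product using (_×_)
open import Data.List.Membership.Propositional using (_∈_)

Var : Set
Var = ℕ

infixr 5 _⇒_
infixr 6 _∨_
infixr 7 _∧_

data Formula : Set where
  var : Var → Formula
  ⊥'  : Formula
  _∧_ : Formula → Formula → Formula
  _∨_ : Formula → Formula → Formula
  ¬'_ : Formula → Formula
  _⇒_ : Formula → Formula → Formula

v⁺ v⁻ : Formula → List Var
v⁺ (var p) = [ p ]
v⁺ ⊥' = []
v⁺ (φ ∧ ψ) = v⁺ φ ++ v⁺ ψ
v⁺ (φ ∨ ψ) = v⁺ φ ++ v⁺ ψ
v⁺ (¬' φ) = v⁻ φ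
v⁺ (φ ⇒ ψ) = v⁻ φ ++ v⁺ ψ
v⁻ (var p) = []
v⁻ ⊥' = []
v⁻ (φ ∧ ψ) = v⁻ φ ++ v⁻ ψ
v⁻ (φ ∨ ψ) = v⁻ φ ++ v⁻ ψ
v⁻ (¬' φ) = v⁺ φ
v⁻ (φ ⇒ ψ) = v⁺ φ ++ v⁻ ψ

-- The Kripke frame of LV: root r with two distinct maximal points a, b above it.
data World : Set where
  r a b : World

data _≼_ : World → World → Set where
  refl-r : r ≼ r
  refl-a : a ≼ a
  refl-b : b ≼ b
  r≼a    : r ≼ a
  r≼b    : r ≼ b

record Valuation : Set where
  field
    val     : World → Var → Bool
    persist : ∀ {w u} p → w ≼ u → T (val w p) → T (val u p)
open Valuation public

_,_⊩_ : Valuation → World → Formula → Set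
V , w ⊩ var p = T (val V w p)
V , w ⊩ ⊥' = ⊥
V , w ⊩ (φ ∧ ψ) = (V , w ⊩ φ) × (V , w ⊩ ψ)
V , w ⊩ (φ ∨ ψ) = (V , w ⊩ φ) Data.Sum.⊎ (V , w ⊩ ψ)
  where import Data.Sum
V , w ⊩ (¬' φ) = ∀ u → w ≼ u → V , u ⊩ φ → ⊥
V , w ⊩ (φ ⇒ ψ) = ∀ u → w ≼ u → V , u ⊩ φ → V , u ⊩ ψ

LV⊢_ : Formula → Set
LV⊢ φ = ∀ (V : Valuation) (w : World) → V , w ⊩ φ

LyndonVars : Formula → Formula → Formula → Set
LyndonVars ρ φ ψ =
  (∀ {p} → p ∈ v⁺ ρ → (p ∈ v⁺ φ) × (p ∈ v⁺ ψ)) ×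
  (∀ {p} → p ∈ v⁻ ρ → (p ∈ v⁻ φ) × (p ∈ v⁻ ψ))

{-# OPTIONS --safe #-}
-- Over the frame r < a, b the common variables see a model only through the truth values at
-- r, a and b of finitely many variables, so there are finitely many rooted models W of φ to
-- consider.  Each has a characteristic formula χ W, in which common positive variables occur
-- only positively and common negative ones only negatively, which holds at the root of W, and
-- which holds in V at w only if some p-morphic image of W lies below V above w (fewer common
-- positive and more common negative variables true).  The interpolant is the disjunction of
-- these χ W.  Every pointed model of φ is a p-morphic image of a rooted one, so φ implies it.
-- Conversely, if V₀ forces φ and lies below V, the valuation taking φ's positive variables
-- from V₀ and ψ's negative ones from V still forces φ, hence ψ, and then so does V.
module Submission where

open import Defs
open import Data.Bool using (Bool; true; false; T)
open import Data.Bool.Properties using (T?)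
open import Data.Empty using (⊥-elim)
open import Data.Nat using (_≟_)
open import Data.List using (List; []; _∷_; [_]; _++_; map; filter; cartesianProduct)
open import Data.List.Membership.Propositional using (_∈_)
open import Data.List.Membership.Propositional.Properties using (∈-++⁺ˡ; ∈-++⁺ʳ; ∈-++⁻; ∈-map⁺; ∈-filter⁺; ∈-filter⁻; ∈-cartesianProduct⁺)
open import Data.List.Membership.DecPropositional _≟_ using (_∈?_)
open import Data.List.Relation.Binary.Subset.Propositional using (_⊆_)
open import Data.List.Relation.Binary.Subset.Propositional.Properties using (xs⊆xs++ys; xs⊆ys++xs)
open import Data.List.Relation.Unary.Any using (here; there)
open import Data.Product using (Σ; ∃-syntax; _×_; _,_; proj₁; proj₂; map₂)
open import Data.Sum using (_⊎_; inj₁; inj₂; [_,_]′)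
import Data.Sum as Sum
open import Function using (_∘_)
open import Relation.Binary.PropositionalEquality using (_≡_; refl)
open import Relation.Nullary using (Dec; yes; no; ¬_; does)
open import Relation.Nullary.Decidable using (⌊_⌋; map′; ¬?; _×-dec_; _⊎-dec_; _→-dec_; decidable-stable; toWitness; fromWitness)
open import Relation.Unary using (Decidable)

private
  variable
    V V' : Valuation
    w u m : World
    P N P' N' : List Var

≼-refl : ∀ w → w ≼ w
≼-refl r = refl-r
≼-refl a = refl-a
≼-refl b = refl-b

≼-trans : ∀ {w u v} → w ≼ u → u ≼ v → w ≼ v
≼-trans refl-r u≼v = u≼v
≼-trans refl-a u≼v = u≼v
≼-trans refl-b u≼v = u≼v
≼-trans r≼a refl-a = r≼a
≼-trans r≼b refl-b = r≼b

r≼ : ∀ w → r ≼ w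
r≼ r = refl-r
r≼ a = r≼a
r≼ b = r≼b

data Maximal : World → Set where
  a-maximal : Maximal a
  b-maximal : Maximal b

maximal-≼ : Maximal m → m ≼ u → m ≡ u
maximal-≼ a-maximal refl-a = refl
maximal-≼ b-maximal refl-b = refl

⊩-persist : ∀ φ → w ≼ u → V , w ⊩ φ → V , u ⊩ φ
⊩-persist {V = V} (var p) w≼u h = persist V p w≼u h
⊩-persist ⊥' w≼u ()
⊩-persist (φ ∧ ψ) w≼u (h₁ , h₂) = ⊩-persist φ w≼u h₁ , ⊩-persist ψ w≼u h₂
⊩-persist (φ ∨ ψ) w≼u = Sum.map (⊩-persist φ w≼u) (⊩-persist ψ w≼u)
⊩-persist (¬' φ) w≼u h v u≼v = h v (≼-trans w≼u u≼v)
⊩-persist (φ ⇒ ψ) w≼u h v u≼v = h v (≼-trans w≼u u≼v)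

∀≼? : {Q : World → Set} → (∀ u → Dec (Q u)) → ∀ w → Dec (∀ u → w ≼ u → Q u)
∀≼? Q? r = map′ (λ (qr , qa , qb) → λ { r _ → qr ; a _ → qa ; b _ → qb })
                (λ h → h r refl-r , h a r≼a , h b r≼b)
                (Q? r ×-dec Q? a ×-dec Q? b)
∀≼? Q? a = map′ (λ q → λ { a _ → q }) (λ h → h a refl-a) (Q? a)
∀≼? Q? b = map′ (λ q → λ { b _ → q }) (λ h → h b refl-b) (Q? b)

⊩? : ∀ V w φ → Dec (V , w ⊩ φ)
⊩? V w (var p) = T? (val V w p)
⊩? V w ⊥' = no λ ()
⊩? V w (φ ∧ ψ) = ⊩? V w φ ×-dec ⊩? V w ψ
⊩? V w (φ ∨ ψ) = ⊩? V w φ ⊎-dec ⊩? V w ψ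
⊩? V w (¬' φ) = ∀≼? (λ u → ¬? (⊩? V u φ)) w
⊩? V w (φ ⇒ ψ) = ∀≼? (λ u → ⊩? V u φ →-dec ⊩? V u ψ) w

⊩¬-maximal : ∀ φ → Maximal m → ¬ (V , m ⊩ φ) → V , m ⊩ (¬' φ)
⊩¬-maximal φ mx ¬h u m≼u with maximal-≼ mx m≼u
... | refl = ¬h

⊩¬¬-root : ∀ φ → ¬ (V , r ⊩ (¬' φ)) → (V , a ⊩ φ) ⊎ (V , b ⊩ φ)
⊩¬¬-root {V} φ ¬¬h with ⊩? V a φ | ⊩? V b φ
... | yes ha | _ = inj₁ ha
... | no _ | yes hb = inj₂ hb
... | no ¬ha | no ¬hb = ⊥-elim (¬¬h λ { r _ h → ¬ha (⊩-persist φ r≼a h) ; a _ → ¬ha ; b _ → ¬hb })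

infix 4 _≤⟨_∣_⟩_ _≤⟨_∣_⟩_↑_

record _≤⟨_∣_⟩_ (g : Var → Bool) (P N : List Var) (h : Var → Bool) : Set where
  constructor mk≤
  field
    on⁺ : ∀ {p} → p ∈ P → T (g p) → T (h p)
    on⁻ : ∀ {p} → p ∈ N → T (h p) → T (g p)
open _≤⟨_∣_⟩_

record _≤⟨_∣_⟩_↑_ (V : Valuation) (P N : List Var) (V' : Valuation) (w : World) : Set where
  constructor mk≤↑
  field
    at : ∀ {u} → w ≼ u → val V u ≤⟨ P ∣ N ⟩ val V' u
open _≤⟨_∣_⟩_↑_

≤-refl : ∀ {g} → g ≤⟨ P ∣ N ⟩ g
≤-refl = mk≤ (λ _ t → t) (λ _ t → t)

≤↑-flip : V ≤⟨ P ∣ N ⟩ V' ↑ w → V' ≤⟨ N ∣ P ⟩ V ↑ w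
≤↑-flip le = mk≤↑ λ w≼u → mk≤ (on⁻ (at le w≼u)) (on⁺ (at le w≼u))

≤↑-up : w ≼ u → V ≤⟨ P ∣ N ⟩ V' ↑ w → V ≤⟨ P ∣ N ⟩ V' ↑ u
≤↑-up w≼u le = mk≤↑ λ u≼v → at le (≼-trans w≼u u≼v)

≤↑-restrict : P' ⊆ P → N' ⊆ N → V ≤⟨ P ∣ N ⟩ V' ↑ w → V ≤⟨ P' ∣ N' ⟩ V' ↑ w
≤↑-restrict P'⊆P N'⊆N le =
  mk≤↑ λ w≼u → mk≤ (on⁺ (at le w≼u) ∘ P'⊆P) (on⁻ (at le w≼u) ∘ N'⊆N)

≤↑-++ˡ : V ≤⟨ P ++ P' ∣ N ++ N' ⟩ V' ↑ w → V ≤⟨ P ∣ N ⟩ V' ↑ w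
≤↑-++ˡ {P = P} {P'} {N} {N'} = ≤↑-restrict (xs⊆xs++ys P P') (xs⊆xs++ys N N')

≤↑-++ʳ : ∀ P N → V ≤⟨ P ++ P' ∣ N ++ N' ⟩ V' ↑ w → V ≤⟨ P' ∣ N' ⟩ V' ↑ w
≤↑-++ʳ {P' = P'} {N' = N'} P N = ≤↑-restrict (xs⊆ys++xs P' P) (xs⊆ys++xs N' N)

≤↑-root : val V r ≤⟨ P ∣ N ⟩ val V' r → val V a ≤⟨ P ∣ N ⟩ val V' a →
          val V b ≤⟨ P ∣ N ⟩ val V' b → V ≤⟨ P ∣ N ⟩ V' ↑ r
≤↑-root at-r at-a at-b = mk≤↑ λ { refl-r → at-r ; r≼a → at-a ; r≼b → at-b }

⊩-monotone : ∀ φ → V ≤⟨ v⁺ φ ∣ v⁻ φ ⟩ V' ↑ w → V , w ⊩ φ → V' , w ⊩ φ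
⊩-monotone {w = w} (var p) le h = on⁺ (at le (≼-refl w)) (here refl) h
⊩-monotone ⊥' le ()
⊩-monotone (φ ∧ ψ) le (h₁ , h₂) =
  ⊩-monotone φ (≤↑-++ˡ le) h₁ , ⊩-monotone ψ (≤↑-++ʳ (v⁺ φ) (v⁻ φ) le) h₂
⊩-monotone (φ ∨ ψ) le =
  Sum.map (⊩-monotone φ (≤↑-++ˡ le)) (⊩-monotone ψ (≤↑-++ʳ (v⁺ φ) (v⁻ φ) le))
⊩-monotone (¬' φ) le h u w≼u h' = h u w≼u (⊩-monotone φ (≤↑-up w≼u (≤↑-flip le)) h')
⊩-monotone (φ ⇒ ψ) le h u w≼u h' =
  ⊩-monotone ψ (≤↑-up w≼u (≤↑-++ʳ (v⁻ φ) (v⁺ φ) le))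
    (h u w≼u (⊩-monotone φ (≤↑-up w≼u (≤↑-flip (≤↑-++ˡ le))) h'))

record PMorphism : Set where
  field
    fun  : World → World
    mono : ∀ {w u} → w ≼ u → fun w ≼ fun u
    back : ∀ {w v} → fun w ≼ v → ∃[ u ] (w ≼ u × fun u ≡ v)
open PMorphism

infixl 8 _∘ᵥ_

_∘ᵥ_ : Valuation → PMorphism → Valuation
V ∘ᵥ f = record { val = λ u → val V (fun f u) ; persist = λ p w≼u → persist V p (mono f w≼u) }

⊩-∘ᵥ⁺ : ∀ φ f → V , fun f w ⊩ φ → (V ∘ᵥ f) , w ⊩ φ
⊩-∘ᵥ⁻ : ∀ φ f → (V ∘ᵥ f) , w ⊩ φ → V , fun f w ⊩ φ

⊩-∘ᵥ⁺ (var p) f h = h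
⊩-∘ᵥ⁺ ⊥' f ()
⊩-∘ᵥ⁺ (φ ∧ ψ) f (h₁ , h₂) = ⊩-∘ᵥ⁺ φ f h₁ , ⊩-∘ᵥ⁺ ψ f h₂
⊩-∘ᵥ⁺ (φ ∨ ψ) f = Sum.map (⊩-∘ᵥ⁺ φ f) (⊩-∘ᵥ⁺ ψ f)
⊩-∘ᵥ⁺ (¬' φ) f h u w≼u h' = h (fun f u) (mono f w≼u) (⊩-∘ᵥ⁻ φ f h')
⊩-∘ᵥ⁺ (φ ⇒ ψ) f h u w≼u h' = ⊩-∘ᵥ⁺ ψ f (h (fun f u) (mono f w≼u) (⊩-∘ᵥ⁻ φ f h'))

⊩-∘ᵥ⁻ (var p) f h = h
⊩-∘ᵥ⁻ ⊥' f ()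
⊩-∘ᵥ⁻ (φ ∧ ψ) f (h₁ , h₂) = ⊩-∘ᵥ⁻ φ f h₁ , ⊩-∘ᵥ⁻ ψ f h₂
⊩-∘ᵥ⁻ (φ ∨ ψ) f = Sum.map (⊩-∘ᵥ⁻ φ f) (⊩-∘ᵥ⁻ ψ f)
⊩-∘ᵥ⁻ (¬' φ) f h v fw≼v h' with back f fw≼v
... | u , w≼u , refl = h u w≼u (⊩-∘ᵥ⁺ φ f h')
⊩-∘ᵥ⁻ (φ ⇒ ψ) f h v fw≼v h' with back f fw≼v
... | u , w≼u , refl = ⊩-∘ᵥ⁻ ψ f (h u w≼u (⊩-∘ᵥ⁺ φ f h'))

idₚ : PMorphism
idₚ = record { fun = λ w → w ; mono = λ w≼u → w≼u ; back = λ {_} {v} w≼v → v , w≼v , refl }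

mirror : World → World
mirror r = r
mirror a = b
mirror b = a

mirrorₚ : PMorphism
mirrorₚ = record { fun = mirror ; mono = mono-mirror ; back = back-mirror }
  where
  mono-mirror : w ≼ u → mirror w ≼ mirror u
  mono-mirror refl-r = refl-r
  mono-mirror refl-a = refl-b
  mono-mirror refl-b = refl-a
  mono-mirror r≼a = r≼b
  mono-mirror r≼b = r≼a
  back-mirror : ∀ {w v} → mirror w ≼ v → ∃[ u ] (w ≼ u × mirror u ≡ v)
  back-mirror {r} refl-r = r , refl-r , refl
  back-mirror {r} r≼a = b , r≼b , refl
  back-mirror {r} r≼b = a , r≼a , refl
  back-mirror {a} refl-b = a , refl-a , refl
  back-mirror {b} refl-a = b , refl-b , refl

constₚ : Maximal m → PMorphism
constₚ {m} mx = record
  { fun = λ _ → m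
  ; mono = λ _ → ≼-refl m
  ; back = λ {w} m≼v → w , ≼-refl w , maximal-≼ mx m≼v
  }

from-root : ∀ φ ψ → (∀ {V} → V , r ⊩ φ → V , r ⊩ ψ) → ∀ w → V , w ⊩ φ → V , w ⊩ ψ
from-root φ ψ rooted r = rooted
from-root φ ψ rooted a = ⊩-∘ᵥ⁻ ψ (constₚ a-maximal) ∘ rooted ∘ ⊩-∘ᵥ⁺ φ (constₚ a-maximal)
from-root φ ψ rooted b = ⊩-∘ᵥ⁻ ψ (constₚ b-maximal) ∘ rooted ∘ ⊩-∘ᵥ⁺ φ (constₚ b-maximal)

⊤' : Formula
⊤' = ⊥' ⇒ ⊥'

⋀ ⋁ : {A : Set} → (A → Formula) → List A → Formula
⋀ F [] = ⊤'
⋀ F (x ∷ xs) = F x ∧ ⋀ F xs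
⋁ F [] = ⊥'
⋁ F (x ∷ xs) = F x ∨ ⋁ F xs

module _ {A : Set} (F : A → Formula) where

  ⊩-⋀⁺ : ∀ xs → (∀ {x} → x ∈ xs → V , w ⊩ F x) → V , w ⊩ ⋀ F xs
  ⊩-⋀⁺ [] k _ _ ()
  ⊩-⋀⁺ (x ∷ xs) k = k (here refl) , ⊩-⋀⁺ xs (k ∘ there)

  ⊩-⋀⁻ : ∀ {xs x} → V , w ⊩ ⋀ F xs → x ∈ xs → V , w ⊩ F x
  ⊩-⋀⁻ (h , _) (here refl) = h
  ⊩-⋀⁻ (_ , h) (there x∈) = ⊩-⋀⁻ h x∈

  ⊩-⋁⁺ : ∀ {xs x} → x ∈ xs → V , w ⊩ F x → V , w ⊩ ⋁ F xs
  ⊩-⋁⁺ (here refl) h = inj₁ h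
  ⊩-⋁⁺ (there x∈) h = inj₂ (⊩-⋁⁺ x∈ h)

  ⊩-⋁⁻ : ∀ xs → V , w ⊩ ⋁ F xs → ∃[ x ] (x ∈ xs × V , w ⊩ F x)
  ⊩-⋁⁻ (x ∷ xs) (inj₁ h) = x , here refl , h
  ⊩-⋁⁻ (x ∷ xs) (inj₂ h) with ⊩-⋁⁻ xs h
  ... | y , y∈ , h' = y , there y∈ , h'

record VarsIn (P N : List Var) (φ : Formula) : Set where
  constructor mkVarsIn
  field
    pos-vars : v⁺ φ ⊆ P
    neg-vars : v⁻ φ ⊆ N
open VarsIn

++-⊆ : ∀ {xs ys zs : List Var} → xs ⊆ zs → ys ⊆ zs → xs ++ ys ⊆ zs
++-⊆ {xs} xs⊆ ys⊆ p∈ = [ xs⊆ , ys⊆ ]′ (∈-++⁻ xs p∈)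

var-vars : ∀ {p} → p ∈ P → VarsIn P N (var p)
var-vars p∈ = mkVarsIn (λ { (here refl) → p∈ }) λ ()

⊥-vars : VarsIn P N ⊥'
⊥-vars = mkVarsIn (λ ()) (λ ())

∧-vars : ∀ {φ ψ} → VarsIn P N φ → VarsIn P N ψ → VarsIn P N (φ ∧ ψ)
∧-vars (mkVarsIn φ⁺ φ⁻) (mkVarsIn ψ⁺ ψ⁻) = mkVarsIn (++-⊆ φ⁺ ψ⁺) (++-⊆ φ⁻ ψ⁻)

∨-vars : ∀ {φ ψ} → VarsIn P N φ → VarsIn P N ψ → VarsIn P N (φ ∨ ψ)
∨-vars (mkVarsIn φ⁺ φ⁻) (mkVarsIn ψ⁺ ψ⁻) = mkVarsIn (++-⊆ φ⁺ ψ⁺) (++-⊆ φ⁻ ψ⁻)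

¬-vars : ∀ {φ} → VarsIn N P φ → VarsIn P N (¬' φ)
¬-vars (mkVarsIn φ⁺ φ⁻) = mkVarsIn φ⁻ φ⁺

⇒-vars : ∀ {φ ψ} → VarsIn N P φ → VarsIn P N ψ → VarsIn P N (φ ⇒ ψ)
⇒-vars (mkVarsIn φ⁺ φ⁻) (mkVarsIn ψ⁺ ψ⁻) = mkVarsIn (++-⊆ φ⁻ ψ⁺) (++-⊆ φ⁺ ψ⁻)

⋀-vars : ∀ {A : Set} {F : A → Formula} xs →
         (∀ {x} → x ∈ xs → VarsIn P N (F x)) → VarsIn P N (⋀ F xs)
⋀-vars [] k = ⇒-vars ⊥-vars ⊥-vars
⋀-vars (x ∷ xs) k = ∧-vars (k (here refl)) (⋀-vars xs (k ∘ there))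

⋁-vars : ∀ {A : Set} {F : A → Formula} xs →
         (∀ {x} → x ∈ xs → VarsIn P N (F x)) → VarsIn P N (⋁ F xs)
⋁-vars [] k = ⊥-vars
⋁-vars (x ∷ xs) k = ∨-vars (k (here refl)) (⋁-vars xs (k ∘ there))

subsets : {A : Set} → List A → List (List A)
subsets [] = [ [] ]
subsets (x ∷ xs) = map (x ∷_) (subsets xs) ++ subsets xs

filter∈subsets : {A : Set} {Q : A → Set} (Q? : Decidable Q) (xs : List A) →
                 filter Q? xs ∈ subsets xs
filter∈subsets Q? [] = here refl
filter∈subsets Q? (x ∷ xs) with does (Q? x)
... | true = ∈-++⁺ˡ (∈-map⁺ (x ∷_) (filter∈subsets Q? xs))
... | false = ∈-++⁺ʳ (map (x ∷_) (subsets xs)) (filter∈subsets Q? xs)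

valuationOf : (H : World → Var → Set) → (∀ u p → Dec (H u p)) →
              (∀ {w u} p → w ≼ u → H w p → H u p) → Valuation
valuationOf H H? persists = record
  { val = λ u p → ⌊ H? u p ⌋
  ; persist = λ p w≼u h → fromWitness (persists p w≼u (toWitness h))
  }

-- The root gets the intersection, so that every triple of sets is persistent.
setValuation : List Var × List Var × List Var → Valuation
setValuation (R , A , B) = valuationOf Holds holds? persists
  where
  Holds : World → Var → Set
  Holds r p = p ∈ R × p ∈ A × p ∈ B
  Holds a p = p ∈ A
  Holds b p = p ∈ B
  holds? : ∀ u p → Dec (Holds u p)
  holds? r p = p ∈? R ×-dec p ∈? A ×-dec p ∈? B
  holds? a p = p ∈? A
  holds? b p = p ∈? B
  persists : ∀ {w u} p → w ≼ u → Holds w p → Holds u p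
  persists p refl-r h = h
  persists p refl-a h = h
  persists p refl-b h = h
  persists p r≼a (_ , h , _) = h
  persists p r≼b (_ , _ , h) = h

valuations : List Var → List Valuation
valuations L = map setValuation (cartesianProduct S (cartesianProduct S S))
  where
  S : List (List Var)
  S = subsets L

valuations-complete : ∀ L V → ∃[ W ] (W ∈ valuations L × W ≤⟨ L ∣ L ⟩ V ↑ r)
valuations-complete L V =
  W ,
  ∈-map⁺ setValuation
    (∈-cartesianProduct⁺ (true-at∈ r) (∈-cartesianProduct⁺ (true-at∈ a) (true-at∈ b))) ,
  ≤↑-root at-r (at-maximal a-maximal) (at-maximal b-maximal)
  where
  true-at : World → List Var
  true-at u = filter (T? ∘ val V u) L
  W : Valuation
  W = setValuation (true-at r , true-at a , true-at b)
  true-at∈ : ∀ u → true-at u ∈ subsets L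
  true-at∈ u = filter∈subsets (T? ∘ val V u) L
  sound : ∀ u {p} → p ∈ true-at u → T (val V u p)
  sound u p∈ = proj₂ (∈-filter⁻ (T? ∘ val V u) {xs = L} p∈)
  complete : ∀ u {p} → p ∈ L → T (val V u p) → p ∈ true-at u
  complete u = ∈-filter⁺ (T? ∘ val V u)
  at-r : val W r ≤⟨ L ∣ L ⟩ val V r
  at-r = mk≤ (λ _ → sound r ∘ proj₁ ∘ toWitness) λ p∈ t →
    fromWitness (complete r p∈ t , complete a p∈ (persist V _ r≼a t) ,
                 complete b p∈ (persist V _ r≼b t))
  at-maximal : Maximal m → val W m ≤⟨ L ∣ L ⟩ val V m
  at-maximal a-maximal = mk≤ (λ _ → sound a ∘ toWitness) (λ p∈ → fromWitness ∘ complete a p∈)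
  at-maximal b-maximal = mk≤ (λ _ → sound b ∘ toWitness) (λ p∈ → fromWitness ∘ complete b p∈)

hall-2×2 : {A B C D : Set} → Dec A → A ⊎ B → C ⊎ D → A ⊎ C → B ⊎ D → (A × D) ⊎ (C × B)
hall-2×2 (yes x) _ (inj₂ d) _ _ = inj₁ (x , d)
hall-2×2 (yes x) _ (inj₁ c) _ (inj₁ y) = inj₂ (c , y)
hall-2×2 (yes x) _ (inj₁ _) _ (inj₂ d) = inj₁ (x , d)
hall-2×2 (no ¬x) (inj₁ x) _ _ _ = ⊥-elim (¬x x)
hall-2×2 (no ¬x) (inj₂ _) _ (inj₁ x) _ = ⊥-elim (¬x x)
hall-2×2 (no ¬x) (inj₂ y) _ (inj₂ c) _ = inj₂ (c , y)

module Characteristic (P N : List Var) where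

  true⁺ false⁻ : (Var → Bool) → List Var
  true⁺ g = filter (T? ∘ g) P
  false⁻ g = filter (¬? ∘ T? ∘ g) N

  true⁺-intro : ∀ {g p} → p ∈ P → T (g p) → p ∈ true⁺ g
  true⁺-intro {g} = ∈-filter⁺ (T? ∘ g)

  true⁺-elim : ∀ {g p} → p ∈ true⁺ g → p ∈ P × T (g p)
  true⁺-elim {g} = ∈-filter⁻ (T? ∘ g) {xs = P}

  false⁻-intro : ∀ {g p} → p ∈ N → ¬ T (g p) → p ∈ false⁻ g
  false⁻-intro {g} = ∈-filter⁺ (¬? ∘ T? ∘ g)

  false⁻-elim : ∀ {g p} → p ∈ false⁻ g → p ∈ N × ¬ T (g p)
  false⁻-elim {g} = ∈-filter⁻ (¬? ∘ T? ∘ g) {xs = N}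

  posAtoms negAtoms χ-max : (Var → Bool) → Formula
  posAtoms g = ⋀ var (true⁺ g)
  negAtoms g = ⋀ (¬'_ ∘ var) (false⁻ g)
  χ-max g = posAtoms g ∧ negAtoms g

  -- χ W: the positive atoms of W's root hold, and unless the current world can still play the
  -- role of W's root (no negative atom false there holds, and both maximal types of W occur
  -- above), it has one of the maximal types of W.
  off-root at-top χ : Valuation → Formula
  off-root W = ⋁ var (false⁻ (val W r)) ∨ ¬' χ-max (val W a) ∨ ¬' χ-max (val W b)
  at-top W = χ-max (val W a) ∨ χ-max (val W b)
  χ W = posAtoms (val W r) ∧ (off-root W ⇒ at-top W)

  posAtoms-vars : ∀ g → VarsIn P N (posAtoms g)
  posAtoms-vars g = ⋀-vars (true⁺ g) (var-vars ∘ proj₁ ∘ true⁺-elim)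

  χ-max-vars : ∀ g → VarsIn P N (χ-max g)
  χ-max-vars g =
    ∧-vars (posAtoms-vars g) (⋀-vars (false⁻ g) (¬-vars ∘ var-vars ∘ proj₁ ∘ false⁻-elim))

  χ-vars : ∀ W → VarsIn P N (χ W)
  χ-vars W =
    ∧-vars (posAtoms-vars (val W r)) (⇒-vars off-root-vars (∨-vars (χ-max-vars _) (χ-max-vars _)))
    where
    off-root-vars : VarsIn N P (off-root W)
    off-root-vars = ∨-vars (⋁-vars (false⁻ (val W r)) (var-vars ∘ proj₁ ∘ false⁻-elim))
                           (∨-vars (¬-vars (χ-max-vars _)) (¬-vars (χ-max-vars _)))

  posAtoms-sound : ∀ {g} → V , w ⊩ posAtoms g → ∀ {p} → p ∈ P → T (g p) → T (val V w p)
  posAtoms-sound h p∈ t = ⊩-⋀⁻ var h (true⁺-intro p∈ t)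

  posAtoms-complete : ∀ {g} → (∀ {p} → p ∈ P → T (g p) → T (val V w p)) → V , w ⊩ posAtoms g
  posAtoms-complete {g = g} k = ⊩-⋀⁺ var (true⁺ g) λ p∈ → let (p∈P , t) = true⁺-elim p∈ in k p∈P t

  χ-max-sound : ∀ {g} → V , w ⊩ χ-max g → ∀ {u} → w ≼ u → g ≤⟨ P ∣ N ⟩ val V u
  χ-max-sound {V} {g = g} (h⁺ , h⁻) w≼u = mk≤
    (λ p∈ t → persist V _ w≼u (posAtoms-sound h⁺ p∈ t))
    (λ p∈ t → decidable-stable (T? (g _)) λ ¬t → ⊩-⋀⁻ (¬'_ ∘ var) h⁻ (false⁻-intro p∈ ¬t) _ w≼u t)

  χ-max-complete : ∀ {g} → (∀ {u} → w ≼ u → g ≤⟨ P ∣ N ⟩ val V u) → V , w ⊩ χ-max g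
  χ-max-complete {w} {g = g} k =
    posAtoms-complete (on⁺ (k (≼-refl w))) ,
    ⊩-⋀⁺ (¬'_ ∘ var) (false⁻ g) λ p∈ u w≼u t →
      let (p∈N , ¬t) = false⁻-elim p∈ in ¬t (on⁻ (k w≼u) p∈N t)

  χ-max-self : ∀ W → Maximal m → W , m ⊩ χ-max (val W m)
  χ-max-self W a-maximal = χ-max-complete λ { refl-a → ≤-refl }
  χ-max-self W b-maximal = χ-max-complete λ { refl-b → ≤-refl }

  χ-self : ∀ W → W , r ⊩ χ W
  χ-self W = posAtoms-complete (λ _ t → t) , off-root⇒at-top
    where
    off-root⇒at-top : W , r ⊩ (off-root W ⇒ at-top W)
    off-root⇒at-top r _ (inj₁ h) with ⊩-⋁⁻ var (false⁻ (val W r)) h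
    ... | _ , p∈ , t = ⊥-elim (proj₂ (false⁻-elim p∈) t)
    off-root⇒at-top r _ (inj₂ (inj₁ ¬χa)) = ⊥-elim (¬χa a r≼a (χ-max-self W a-maximal))
    off-root⇒at-top r _ (inj₂ (inj₂ ¬χb)) = ⊥-elim (¬χb b r≼b (χ-max-self W b-maximal))
    off-root⇒at-top a _ _ = inj₁ (χ-max-self W a-maximal)
    off-root⇒at-top b _ _ = inj₂ (χ-max-self W b-maximal)

  at-top-maximal : ∀ W → Maximal m → V , m ⊩ (off-root W ⇒ at-top W) → V , m ⊩ at-top W
  at-top-maximal {m} {V} W mx imp with ⊩? V m (χ-max (val W a))
  ... | yes h = inj₁ h
  ... | no ¬h = imp m (≼-refl m) (inj₂ (inj₁ (⊩¬-maximal (χ-max (val W a)) mx ¬h)))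

  -- Both maximal types of W occur above r and each of a, b has one of them, so they occur at a
  -- and b in some order.
  χ-sound-root : ∀ W → V , r ⊩ χ W → ¬ (V , r ⊩ at-top W) → ∃[ f ] (W ∘ᵥ f ≤⟨ P ∣ N ⟩ V ↑ r)
  χ-sound-root {V} W (root , imp) ¬at-top =
    [ (λ (aa , bb) → idₚ , ≤↑-root below-r (χ-max-sound aa refl-a) (χ-max-sound bb refl-b))
    , (λ (ba , ab) → mirrorₚ , ≤↑-root below-r (χ-max-sound ba refl-a) (χ-max-sound ab refl-b))
    ]′ (hall-2×2 (⊩? V a (χ-max (val W a))) realised-a realised-b at-a at-b)
    where
    ¬off-root : ¬ (V , r ⊩ off-root W)
    ¬off-root = ¬at-top ∘ imp r refl-r
    below-r : val W r ≤⟨ P ∣ N ⟩ val V r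
    below-r = mk≤ (posAtoms-sound root) λ p∈ t →
      decidable-stable (T? _) λ ¬t → ¬off-root (inj₁ (⊩-⋁⁺ var (false⁻-intro p∈ ¬t) t))
    realised-a = ⊩¬¬-root (χ-max (val W a)) (¬off-root ∘ inj₂ ∘ inj₁)
    realised-b = ⊩¬¬-root (χ-max (val W b)) (¬off-root ∘ inj₂ ∘ inj₂)
    at-a = at-top-maximal W a-maximal (⊩-persist (off-root W ⇒ at-top W) r≼a imp)
    at-b = at-top-maximal W b-maximal (⊩-persist (off-root W ⇒ at-top W) r≼b imp)

  χ-sound : ∀ w W → V , w ⊩ χ W → ∃[ f ] (W ∘ᵥ f ≤⟨ P ∣ N ⟩ V ↑ w)
  χ-sound {V} w W χW with ⊩? V w (at-top W)
  ... | yes (inj₁ h) = constₚ a-maximal , mk≤↑ (χ-max-sound h)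
  ... | yes (inj₂ h) = constₚ b-maximal , mk≤↑ (χ-max-sound h)
  χ-sound r W χW | no ¬at-top = χ-sound-root W χW ¬at-top
  χ-sound a W (_ , imp) | no ¬at-top = ⊥-elim (¬at-top (at-top-maximal W a-maximal imp))
  χ-sound b W (_ , imp) | no ¬at-top = ⊥-elim (¬at-top (at-top-maximal W b-maximal imp))

module Interpolant (φ : Formula) (P N : List Var) where
  open Characteristic P N

  support : List Var
  support = v⁺ φ ++ v⁻ φ ++ P ++ N

  rooted-model? : ∀ W → Dec (W , r ⊩ φ)
  rooted-model? W = ⊩? W r φ

  models : List Valuation
  models = filter rooted-model? (valuations support)

  interpolant : Formula
  interpolant = ⋁ χ models

  interpolant-vars : VarsIn P N interpolant
  interpolant-vars = ⋁-vars models (λ {W} _ → χ-vars W)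

  interpolant-complete : ∀ w → V , w ⊩ φ → V , w ⊩ interpolant
  interpolant-complete = from-root φ interpolant rooted
    where
    v⁺⊆ : v⁺ φ ⊆ support
    v⁺⊆ = ∈-++⁺ˡ
    v⁻⊆ : v⁻ φ ⊆ support
    v⁻⊆ = ∈-++⁺ʳ (v⁺ φ) ∘ ∈-++⁺ˡ
    P⊆ : P ⊆ support
    P⊆ = ∈-++⁺ʳ (v⁺ φ) ∘ ∈-++⁺ʳ (v⁻ φ) ∘ ∈-++⁺ˡ
    N⊆ : N ⊆ support
    N⊆ = ∈-++⁺ʳ (v⁺ φ) ∘ ∈-++⁺ʳ (v⁻ φ) ∘ ∈-++⁺ʳ P
    rooted : V , r ⊩ φ → V , r ⊩ interpolant
    rooted {V} h with valuations-complete support V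
    ... | W , W∈ , W≤V = ⊩-monotone interpolant W≤V-on-interpolant (⊩-⋁⁺ χ W∈models (χ-self W))
      where
      W∈models : W ∈ models
      W∈models = ∈-filter⁺ rooted-model? W∈ (⊩-monotone φ (≤↑-restrict v⁺⊆ v⁻⊆ (≤↑-flip W≤V)) h)
      W≤V-on-interpolant : W ≤⟨ v⁺ interpolant ∣ v⁻ interpolant ⟩ V ↑ r
      W≤V-on-interpolant =
        ≤↑-restrict (P⊆ ∘ pos-vars interpolant-vars) (N⊆ ∘ neg-vars interpolant-vars) W≤V

  interpolant-sound : ∀ w → V , w ⊩ interpolant → ∃[ V₀ ] ((V₀ , w ⊩ φ) × V₀ ≤⟨ P ∣ N ⟩ V ↑ w)
  interpolant-sound w h with ⊩-⋁⁻ χ models h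
  ... | W , W∈ , χW with χ-sound w W χW
  ... | f , W∘f≤V = W ∘ᵥ f , ⊩-∘ᵥ⁺ φ f (⊩-persist φ (r≼ _) W⊩φ) , W∘f≤V
    where
    W⊩φ : W , r ⊩ φ
    W⊩φ = proj₂ (∈-filter⁻ rooted-model? {xs = valuations support} W∈)

common⁺ common⁻ : Formula → Formula → List Var
common⁺ φ ψ = filter (_∈? v⁺ ψ) (v⁺ φ)
common⁻ φ ψ = filter (_∈? v⁻ ψ) (v⁻ φ)

entails-from-below : ∀ φ ψ {V₀} → LV⊢ (φ ⇒ ψ) →
                     V₀ , w ⊩ φ → V₀ ≤⟨ common⁺ φ ψ ∣ common⁻ φ ψ ⟩ V ↑ w → V , w ⊩ ψ
entails-from-below {w} {V} φ ψ {V₀} ⊢φ⇒ψ h V₀≤V =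
  ⊩-monotone ψ V₁≤V (⊢φ⇒ψ V₁ w w (≼-refl w) (⊩-monotone φ V₀≤V₁ h))
  where
  Mixed : World → Var → Set
  Mixed u p = (p ∈ v⁺ φ × T (val V₀ u p)) ⊎ (p ∈ v⁻ ψ × T (val V u p))
  V₁ : Valuation
  V₁ = valuationOf Mixed (λ u p → (p ∈? v⁺ φ ×-dec T? _) ⊎-dec (p ∈? v⁻ ψ ×-dec T? _))
         (λ p u≼v → Sum.map (map₂ (persist V₀ p u≼v)) (map₂ (persist V p u≼v)))
  common⁻-in-V₀ : ∀ {u p} → w ≼ u → p ∈ v⁻ φ → Mixed u p → T (val V₀ u p)
  common⁻-in-V₀ w≼u p∈ =
    [ proj₂ , (λ (p∈′ , t) → on⁻ (at V₀≤V w≼u) (∈-filter⁺ (_∈? v⁻ ψ) p∈ p∈′) t) ]′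
  common⁺-in-V : ∀ {u p} → w ≼ u → p ∈ v⁺ ψ → Mixed u p → T (val V u p)
  common⁺-in-V w≼u p∈ =
    [ (λ (p∈′ , t) → on⁺ (at V₀≤V w≼u) (∈-filter⁺ (_∈? v⁺ ψ) p∈′ p∈) t) , proj₂ ]′
  V₀≤V₁ : V₀ ≤⟨ v⁺ φ ∣ v⁻ φ ⟩ V₁ ↑ w
  V₀≤V₁ = mk≤↑ λ w≼u →
    mk≤ (λ p∈ t → fromWitness (inj₁ (p∈ , t))) (λ p∈ → common⁻-in-V₀ w≼u p∈ ∘ toWitness)
  V₁≤V : V₁ ≤⟨ v⁺ ψ ∣ v⁻ ψ ⟩ V ↑ w
  V₁≤V = mk≤↑ λ w≼u →
    mk≤ (λ p∈ → common⁺-in-V w≼u p∈ ∘ toWitness) (λ p∈ t → fromWitness (inj₂ (p∈ , t)))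

common-LyndonVars : ∀ φ ψ {ρ} → VarsIn (common⁺ φ ψ) (common⁻ φ ψ) ρ → LyndonVars ρ φ ψ
common-LyndonVars φ ψ ρ-vars =
  ∈-filter⁻ (_∈? v⁺ ψ) ∘ pos-vars ρ-vars , ∈-filter⁻ (_∈? v⁻ ψ) ∘ neg-vars ρ-vars

corollary10p4 : (φ ψ : Formula) → LV⊢ (φ ⇒ ψ) →
    Σ Formula (λ ρ → LyndonVars ρ φ ψ × (LV⊢ (φ ⇒ ρ)) × (LV⊢ (ρ ⇒ ψ)))
corollary10p4 φ ψ ⊢φ⇒ψ =
  interpolant , common-LyndonVars φ ψ interpolant-vars , ⊢φ⇒interpolant , ⊢interpolant⇒ψ
  where
  open Interpolant φ (common⁺ φ ψ) (common⁻ φ ψ)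
  ⊢φ⇒interpolant : LV⊢ (φ ⇒ interpolant)
  ⊢φ⇒interpolant _ _ u _ = interpolant-complete u
  ⊢interpolant⇒ψ : LV⊢ (interpolant ⇒ ψ)
  ⊢interpolant⇒ψ _ _ u _ h =
    let (V₀ , V₀⊩φ , V₀≤V) = interpolant-sound u h in entails-from-below φ ψ ⊢φ⇒ψ V₀⊩φ V₀≤V
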